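{- Fix $k\ge 2$ and an alphabet $A=\{a_1,\dots,a_k\}$, and for each $n$ let $Q=Q_n$ be a set of words of length $n$ over $A$. Suppose $\Pr(W_k(n)\in Q)=1-o(n^{ -k/2})$ as $n\to\infty$. Then for every choice, for each $n$, of nonnegative integers $M_i=n/k+\omega_i$ ($i=1,\dots,k$) with $\sum_{i}\omega_i=0$ and $|\omega_i|\le\sqrt{(n\log n)/(3k^2)}$ for all $i$, we have $\Pr(W(n;M_1,\dots,M_k)\in Q)\to 1$ as $n\to\infty$.
   Context: $W_k(n)$ is a word chosen uniformly at random among all $k^n$ words of length $n$ over $A$. For nonnegative integers $M_1,\dots,M_k$ with $M_1+\cdots+M_k=n$, the fixed-letter-count random word $W(n;M_1,\dots,M_k)$ is chosen uniformly at random among all $\binom{n}{M_1,\dots,M_k}$ words of length $n$ in which letter $a_i$ occurs exactly $M_i$ times for each $i$. -}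

module Defs where

open import Data.Bool using (Bool; true; false; not; _∧_)
open import Data.Nat using (ℕ; zero; suc; _+_; _*_; _^_; _≤_; _≡ᵇ_; ∣_-_∣; _!)
open import Data.Fin using (Fin; _≟_)
open import Data.Vec using (Vec; []; _∷_)
import Data.Vec as Vec
open import Data.List using (List; [_]; concatMap; map; length; filterᵇ; allFin; foldr)
open import Relation.Nullary.Decidable using (⌊_⌋)

Word : ℕ → ℕ → Set
Word k n = Vec (Fin k) n

allWords : (k n : ℕ) → List (Word k n)
allWords k zero = [ [] ]
allWords k (suc n) = concatMap (λ a → map (a ∷_) (allWords k n)) (allFin k)

sumFin : (k : ℕ) → (Fin k → ℕ) → ℕ
sumFin k f = foldr _+_ 0 (map f (allFin k))

letterCount : {k n : ℕ} → Word k n → Fin k → ℕ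
letterCount w i = Vec.count (λ b → i ≟ b) w

hasCounts : {k n : ℕ} → (Fin k → ℕ) → Word k n → Bool
hasCounts {k} M w = foldr _∧_ true (map (λ i → letterCount w i ≡ᵇ M i) (allFin k))

-- Number of words of length n NOT in Q  (so Pr(W_k(n) ∉ Q) = badAll / k^n).
badAll : (k n : ℕ) → (Word k n → Bool) → ℕ
badAll k n Q = length (filterᵇ (λ w → not (Q w)) (allWords k n))

-- Number of words with letter counts M  (= multinomial(n; M_1,…,M_k)).
totalFixed : (k n : ℕ) → (Fin k → ℕ) → ℕ
totalFixed k n M = length (filterᵇ (hasCounts M) (allWords k n))

badFixed : (k n : ℕ) → (Fin k → ℕ) → (Word k n → Bool) → ℕ
badFixed k n M Q = length (filterᵇ (λ w → hasCounts M w ∧ not (Q w)) (allWords k n))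

-- expPS x m = m! * Σ_{j=0}^{m} x^j / j!   (a natural number).
expPS : ℕ → ℕ → ℕ
expPS x zero = 1
expPS x (suc m) = suc m * expPS x m + x ^ suc m

-- x ≤ ln N  (for natural x, N):  e^x ≤ N, i.e. every partial sum of the
-- exponential series Σ_{j≤m} x^j/j! is ≤ N (the partial sums increase to e^x).
LeLog : ℕ → ℕ → Set
LeLog x N = ∀ m → expPS x m ≤ m ! * N

-- |ω_i| ≤ sqrt(n log n / (3k²)) with ω_i = M_i − n/k, i.e.
-- 3 (k M_i − n)² ≤ n ln n, i.e. 3 (k M_i − n)² ≤ ln (n^n).
DevBound : (k n m : ℕ) → Set
DevBound k n m = LeLog (3 * (∣ k * m - n ∣ * ∣ k * m - n ∣)) (n ^ n)

-- Let T = n!/∏ M_i! be the number of words with letter counts M, so that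
-- Pr(W(n;M) ∉ Q) ≤ badAll/T. Compare M, letter by letter, with the balanced
-- counts B_i ∈ {⌊n/k⌋, ⌈n/k⌉}: the deviation bound e^(3(kM_i - n)²) ≤ n^n gives
-- M_i! (k/n)^M_i ≤ B_i! (k/n)^B_i (2^(4k) n)^(1/2k), and an induction on q gives
-- (kq)!/(q!)^k ≥ k^(kq) / (k^k q^((k-1)/2)). Multiplying out, k^n ≤ √K T n^(k/2)
-- for a constant K depending only on k, so badAll = o(k^n n^(-k/2)) forces
-- badFixed ≤ badAll = o(T).

module Submission where

open import Defs
open import Data.Nat hiding (_≟_)
open import Data.Nat.Properties hiding (_≟_)
open import Data.Nat.Combinatorics using (_C_; _P_; nCk≡nC[n∸k]; nCk≡nPk/k!)
open import Data.Nat.Combinatorics.Base using (_P′_)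
open import Data.Nat.Combinatorics.Specification using (nP′k≡n[n∸1P′k∸1])
open import Data.Nat.DivMod using (_/_; _%_; m/n*n≤m; m≡m%n+[m/n]*n; m%n<n)
open import Data.Nat.Tactic.RingSolver using (solve-∀)
open import Data.Bool using (Bool; true; false; not; _∧_; if_then_else_)
open import Data.Bool.Properties using (∧-zeroʳ)
open import Data.Fin using (Fin; zero; suc; toℕ; _≟_)
open import Data.Fin.Properties using (toℕ≤pred[n])
open import Data.List using (List; []; _∷_; _++_; map; concatMap; filterᵇ; length; foldr; tabulate; allFin)
open import Data.List.Properties using (map-tabulate; length-++; filter-++)
open import Data.Vec using ([]; _∷_)
import Data.Vec.Functional as Vector
open import Data.Vec.Functional.Properties using (updateAt-updates; updateAt-minimal)
open import Data.Product using (Σ; ∃; _×_; _,_; proj₁; proj₂)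
open import Data.Sum using (inj₁; inj₂)
open import Data.Unit using (tt)
open import Data.Empty using (⊥-elim)
open import Function using (_∘_; id)
open import Relation.Nullary using (yes; no)
open import Relation.Nullary.Decidable using (T?)
open import Relation.Nullary.Negation using (contradiction)
open import Relation.Binary.PropositionalEquality
open import Algebra.Bundles using (CommutativeSemiring)
import Algebra.Definitions.RawMonoid as RawMonoid
import Algebra.Definitions.RawSemiring as RawSemiring
import Algebra.Properties.CommutativeSemiring.Binomial as Binomial
import Algebra.Properties.CommutativeSemiring.Exp +-*-commutativeSemiring as Exp
open import Algebra.Properties.CommutativeSemigroup *-commutativeSemigroup using (x∙yz≈y∙xz; interchange)
open import Algebra.Properties.Monoid.Sum +-0-monoid using (sum; sum-cong-≗)
open import Algebra.Properties.Semiring.Sum +-*-semiring using (*-distribˡ-sum; *-distribʳ-sum)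
open import Algebra.Properties.CommutativeMonoid.Sum *-1-commutativeMonoid using ()
  renaming (sum to prod; sum-cong-≗ to prod-cong-≗; sum-replicate-zero to prod-replicate-one; ∑-distrib-+ to prod-distrib-*)

open CommutativeSemiring +-*-commutativeSemiring using (rawSemiring; +-rawMonoid)
open RawSemiring rawSemiring using () renaming (_^_ to _^ᴿ_)
open RawMonoid +-rawMonoid using () renaming (_×_ to _×ᴿ_)

^ᴿ≡^ : ∀ x n → x ^ᴿ n ≡ x ^ n
^ᴿ≡^ x zero = refl
^ᴿ≡^ x (suc n) = cong (x *_) (^ᴿ≡^ x n)

×ᴿ≡* : ∀ n x → n ×ᴿ x ≡ n * x
×ᴿ≡* zero x = refl
×ᴿ≡* (suc n) x = cong (x +_) (×ᴿ≡* n x)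

*-distrib-^ : ∀ a b n → (a * b) ^ n ≡ a ^ n * b ^ n
*-distrib-^ a b n = trans (sym (^ᴿ≡^ (a * b) n)) (trans (Exp.^-distrib-* a b n) (cong₂ _*_ (^ᴿ≡^ a n) (^ᴿ≡^ b n)))

^-cancelʳ-≤ : ∀ {a b} e {{_ : NonZero e}} → a ^ e ≤ b ^ e → a ≤ b
^-cancelʳ-≤ {a} {b} e aᵉ≤bᵉ with a ≤? b
... | yes a≤b = a≤b
... | no a≰b = contradiction aᵉ≤bᵉ (<⇒≱ (^-monoˡ-< e (≰⇒> a≰b)))

n^n≢0 : ∀ n → NonZero (n ^ n)
n^n≢0 zero = _
n^n≢0 (suc n) = m^n≢0 (suc n) (suc n)

^*-cancel : ∀ {a b c} e n {{_ : NonZero n}} → a ^ (e * n) ≤ b ^ (e * n) * c ^ n → a ^ e ≤ b ^ e * c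
^*-cancel {a} {b} {c} e n h = ^-cancelʳ-≤ n (begin
  (a ^ e) ^ n         ≡⟨ ^-*-assoc a e n ⟩
  a ^ (e * n)         ≤⟨ h ⟩
  b ^ (e * n) * c ^ n ≡⟨ cong (_* c ^ n) (^-*-assoc b e n) ⟨
  (b ^ e) ^ n * c ^ n ≡⟨ *-distrib-^ (b ^ e) c n ⟨
  (b ^ e * c) ^ n     ∎)
  where open ≤-Reasoning

x*y^m*y^n≡x*y^[m+n] : ∀ x y m n → x * y ^ m * y ^ n ≡ x * y ^ (m + n)
x*y^m*y^n≡x*y^[m+n] x y m n = trans (*-assoc x (y ^ m) (y ^ n)) (cong (x *_) (sym (^-distribˡ-+-* y m n)))

*-^-bound : ∀ {x y c} z e → x ^ e ≤ y ^ e * c → (z * x) ^ e ≤ (z * y) ^ e * c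
*-^-bound {x} {y} {c} z e xᵉ≤ = begin
  (z * x) ^ e          ≡⟨ *-distrib-^ z x e ⟩
  z ^ e * x ^ e        ≤⟨ *-monoʳ-≤ (z ^ e) xᵉ≤ ⟩
  z ^ e * (y ^ e * c)  ≡⟨ *-assoc (z ^ e) (y ^ e) c ⟨
  z ^ e * y ^ e * c    ≡⟨ cong (_* c) (*-distrib-^ z y e) ⟨
  (z * y) ^ e * c      ∎
  where open ≤-Reasoning

*-^-cancel : ∀ {x y c} z e {{_ : NonZero z}} → (z * x) ^ e ≤ (z * y) ^ e * c → x ^ e ≤ y ^ e * c
*-^-cancel {x} {y} {c} z e zxᵉ≤ = *-cancelˡ-≤ (z ^ e) {{m^n≢0 z e}} (begin
  z ^ e * x ^ e        ≡⟨ *-distrib-^ z x e ⟨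
  (z * x) ^ e          ≤⟨ zxᵉ≤ ⟩
  (z * y) ^ e * c      ≡⟨ cong (_* c) (*-distrib-^ z y e) ⟩
  z ^ e * y ^ e * c    ≡⟨ *-assoc (z ^ e) (y ^ e) c ⟩
  z ^ e * (y ^ e * c)  ∎)
  where open ≤-Reasoning

^^-bound : ∀ {x y c} d e → x ^ (d * e) ≤ y ^ (d * e) * c → (x ^ d) ^ e ≤ (y ^ d) ^ e * c
^^-bound {x} {y} {c} d e h = subst₂ (λ l r → l ≤ r * c) (sym (^-*-assoc x d e)) (sym (^-*-assoc y d e)) h

^-ratio-mono : ∀ {X Y} e f → Y ≤ X → e ≤ f → X ^ e * Y ^ f ≤ Y ^ e * X ^ f
^-ratio-mono {X} {Y} e f Y≤X e≤f with m≤n⇒∃[o]m+o≡n e≤f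
... | t , refl = begin
  X ^ e * Y ^ (e + t)        ≡⟨ cong (X ^ e *_) (^-distribˡ-+-* Y e t) ⟩
  X ^ e * (Y ^ e * Y ^ t)    ≡⟨ x∙yz≈y∙xz (X ^ e) (Y ^ e) (Y ^ t) ⟩
  Y ^ e * (X ^ e * Y ^ t)    ≤⟨ *-monoʳ-≤ (Y ^ e) (*-monoʳ-≤ (X ^ e) (^-monoˡ-≤ t Y≤X)) ⟩
  Y ^ e * (X ^ e * X ^ t)    ≡⟨ cong (Y ^ e *_) (^-distribˡ-+-* X e t) ⟨
  Y ^ e * X ^ (e + t)        ∎
  where open ≤-Reasoning

^-ratio-bound : ∀ {X Y a b} {{_ : NonZero Y}} {{_ : NonZero (a * b)}} e g h → e ≤ g + h →
  X ^ g ≤ Y ^ g * a → X ^ h ≤ Y ^ h * b → X ^ e ≤ Y ^ e * (a * b)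
^-ratio-bound {X} {Y} {a} {b} e g h e≤g+h Xᵍ≤ Xʰ≤ with ≤-total X Y
... | inj₁ X≤Y = ≤-trans (^-monoˡ-≤ e X≤Y) (m≤m*n (Y ^ e) (a * b))
... | inj₂ Y≤X = *-cancelʳ-≤ _ _ (Y ^ (g + h)) {{m^n≢0 Y (g + h)}} (begin
  X ^ e * Y ^ (g + h)               ≤⟨ ^-ratio-mono e (g + h) Y≤X e≤g+h ⟩
  Y ^ e * X ^ (g + h)               ≡⟨ cong (Y ^ e *_) (^-distribˡ-+-* X g h) ⟩
  Y ^ e * (X ^ g * X ^ h)           ≤⟨ *-monoʳ-≤ (Y ^ e) (*-mono-≤ Xᵍ≤ Xʰ≤) ⟩
  Y ^ e * (Y ^ g * a * (Y ^ h * b)) ≡⟨ cong (Y ^ e *_) (interchange (Y ^ g) a (Y ^ h) b) ⟩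
  Y ^ e * (Y ^ g * Y ^ h * (a * b)) ≡⟨ cong (λ z → Y ^ e * (z * (a * b))) (^-distribˡ-+-* Y g h) ⟨
  Y ^ e * (Y ^ (g + h) * (a * b))   ≡⟨ regroup (Y ^ e) (Y ^ (g + h)) (a * b) ⟩
  Y ^ e * (a * b) * Y ^ (g + h)     ∎)
  where
  open ≤-Reasoning
  regroup : ∀ x y z → x * (y * z) ≡ x * z * y
  regroup = solve-∀

^-≤-double : ∀ {X Y} e → X ≤ 2 * Y → X ^ e ≤ Y ^ e * 2 ^ e
^-≤-double {X} {Y} e X≤2Y = begin
  X ^ e          ≤⟨ ^-monoˡ-≤ e X≤2Y ⟩
  (2 * Y) ^ e    ≡⟨ *-distrib-^ 2 Y e ⟩
  2 ^ e * Y ^ e  ≡⟨ *-comm (2 ^ e) (Y ^ e) ⟩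
  Y ^ e * 2 ^ e  ∎
  where open ≤-Reasoning

infix 10 _²
_² : ℕ → ℕ
n ² = n * n

*-distrib-² : ∀ m n → (m * n) ² ≡ m ² * n ²
*-distrib-² m n = interchange m n m n

²-mono-≤ : ∀ {m n} → m ≤ n → m ² ≤ n ²
²-mono-≤ m≤n = *-mono-≤ m≤n m≤n

x^2≡x² : ∀ x → x ^ 2 ≡ x ²
x^2≡x² x = cong (x *_) (*-identityʳ x)

x≤y+z⇒z≤y⇒x≤2y : ∀ {x y z} → x ≤ y + z → z ≤ y → x ≤ 2 * y
x≤y+z⇒z≤y⇒x≤2y {x} {y} x≤y+z z≤y =
  ≤-trans x≤y+z (≤-trans (+-monoʳ-≤ y z≤y) (≤-reflexive (cong (y +_) (sym (+-identityʳ y)))))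

∣m-n∣≤u⇒m≤n+u : ∀ {m n u} → ∣ m - n ∣ ≤ u → m ≤ n + u
∣m-n∣≤u⇒m≤n+u {m} {n} ∣m-n∣≤u =
  ≤-trans (m≤n+m∸n m n) (+-monoʳ-≤ n (≤-trans (m∸n≤∣m-n∣ m n) ∣m-n∣≤u))

sum-mono-≤ : ∀ {n} {f g : Fin n → ℕ} → (∀ i → f i ≤ g i) → sum f ≤ sum g
sum-mono-≤ {zero} f≤g = z≤n
sum-mono-≤ {suc n} f≤g = +-mono-≤ (f≤g zero) (sum-mono-≤ (f≤g ∘ suc))

prod-mono-≤ : ∀ {k} {f g : Fin k → ℕ} → (∀ i → f i ≤ g i) → prod f ≤ prod g
prod-mono-≤ {zero} f≤g = ≤-refl
prod-mono-≤ {suc k} f≤g = *-mono-≤ (f≤g zero) (prod-mono-≤ (f≤g ∘ suc))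

prod-positive : ∀ {k} (f : Fin k → ℕ) → (∀ i → 0 < f i) → 0 < prod f
prod-positive {zero} f f>0 = s≤s z≤n
prod-positive {suc k} f f>0 = *-mono-≤ (f>0 zero) (prod-positive (f ∘ suc) (f>0 ∘ suc))

prod-^ : ∀ {k} (f : Fin k → ℕ) e → prod (λ i → f i ^ e) ≡ prod f ^ e
prod-^ {zero} f e = sym (^-zeroˡ e)
prod-^ {suc k} f e = trans (cong (f zero ^ e *_) (prod-^ (f ∘ suc) e)) (sym (*-distrib-^ (f zero) _ e))

prod-const : ∀ k c → prod {k} (λ _ → c) ≡ c ^ k
prod-const zero c = refl
prod-const (suc k) c = cong (c *_) (prod-const k c)

prod-^ʳ : ∀ {k} c (f : Fin k → ℕ) → prod (λ i → c ^ f i) ≡ c ^ sum f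
prod-^ʳ {zero} c f = refl
prod-^ʳ {suc k} c f = trans (cong (c ^ f zero *_) (prod-^ʳ c (f ∘ suc))) (sym (^-distribˡ-+-* c (f zero) _))

-- Counting words

count : {A : Set} → (A → Bool) → List A → ℕ
count p xs = length (filterᵇ p xs)

count-++ : ∀ {A : Set} (p : A → Bool) xs ys → count p (xs ++ ys) ≡ count p xs + count p ys
count-++ p xs ys = trans (cong length (filter-++ (T? ∘ p) xs ys)) (length-++ (filterᵇ p xs))

count-map : ∀ {A B : Set} (p : B → Bool) (h : A → B) xs → count p (map h xs) ≡ count (p ∘ h) xs
count-map p h [] = refl
count-map p h (x ∷ xs) with p (h x)
... | true = cong suc (count-map p h xs)
... | false = count-map p h xs

count-concatMap : ∀ {A B : Set} (p : B → Bool) (h : A → List B) xs →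
  count p (concatMap h xs) ≡ foldr _+_ 0 (map (count p ∘ h) xs)
count-concatMap p h [] = refl
count-concatMap p h (x ∷ xs) =
  trans (count-++ p (h x) (concatMap h xs)) (cong (count p (h x) +_) (count-concatMap p h xs))

count-cong : ∀ {A : Set} {p q : A → Bool} → (∀ x → p x ≡ q x) → ∀ xs → count p xs ≡ count q xs
count-cong p≗q [] = refl
count-cong {q = q} p≗q (x ∷ xs) rewrite p≗q x with q x
... | true = cong suc (count-cong p≗q xs)
... | false = count-cong p≗q xs

count-false : ∀ {A : Set} {p : A → Bool} → (∀ x → p x ≡ false) → ∀ xs → count p xs ≡ 0
count-false p≡false [] = refl
count-false p≡false (x ∷ xs) rewrite p≡false x = count-false p≡false xs

count-∧≤ : ∀ {A : Set} (p q : A → Bool) xs → count (λ x → p x ∧ q x) xs ≤ count q xs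
count-∧≤ p q [] = z≤n
count-∧≤ p q (x ∷ xs) with p x | q x
... | true | true = s≤s (count-∧≤ p q xs)
... | true | false = count-∧≤ p q xs
... | false | true = m≤n⇒m≤1+n (count-∧≤ p q xs)
... | false | false = count-∧≤ p q xs

foldr-map-allFin : ∀ {A : Set} (_∙_ : A → A → A) e {k} (f : Fin k → A) →
  foldr _∙_ e (map f (allFin k)) ≡ Vector.foldr _∙_ e f
foldr-map-allFin _∙_ e {k} f = trans (cong (foldr _∙_ e) (map-tabulate id f)) (foldr-tabulate f)
  where
  foldr-tabulate : ∀ {k} (g : Fin k → _) → foldr _∙_ e (tabulate g) ≡ Vector.foldr _∙_ e g
  foldr-tabulate {zero} g = refl
  foldr-tabulate {suc k} g = cong (g zero ∙_) (foldr-tabulate (g ∘ suc))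

sumFin≡sum : ∀ k f → sumFin k f ≡ sum f
sumFin≡sum k = foldr-map-allFin _+_ 0

count-allWords-suc : ∀ k n (p : Word k (suc n) → Bool) →
  count p (allWords k (suc n)) ≡ sum (λ a → count (p ∘ (a ∷_)) (allWords k n))
count-allWords-suc k n p = begin
  count p (concatMap (λ a → map (a ∷_) (allWords k n)) (allFin k))
    ≡⟨ count-concatMap p _ (allFin k) ⟩
  sumFin k (λ a → count p (map (a ∷_) (allWords k n)))
    ≡⟨ sumFin≡sum k _ ⟩
  sum (λ a → count p (map (a ∷_) (allWords k n)))
    ≡⟨ sum-cong-≗ (λ a → count-map p (a ∷_) (allWords k n)) ⟩
  sum (λ a → count (p ∘ (a ∷_)) (allWords k n)) ∎
  where open ≡-Reasoning

allTrue : ∀ {k} → (Fin k → Bool) → Bool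
allTrue = Vector.foldr _∧_ true

allTrue-cong : ∀ {k} {f g : Fin k → Bool} → (∀ i → f i ≡ g i) → allTrue f ≡ allTrue g
allTrue-cong {zero} f≗g = refl
allTrue-cong {suc k} f≗g = cong₂ _∧_ (f≗g zero) (allTrue-cong (f≗g ∘ suc))

allTrue-false : ∀ {k} (f : Fin k → Bool) i → f i ≡ false → allTrue f ≡ false
allTrue-false f zero fi≡false rewrite fi≡false = refl
allTrue-false f (suc i) fi≡false rewrite allTrue-false (f ∘ suc) i fi≡false = ∧-zeroʳ (f zero)

allTrue-true : ∀ {k} (f : Fin k → Bool) → (∀ i → f i ≡ true) → allTrue f ≡ true
allTrue-true {zero} f f≡true = refl
allTrue-true {suc k} f f≡true rewrite f≡true zero = allTrue-true (f ∘ suc) (f≡true ∘ suc)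

hasCounts≡allTrue : ∀ {k n} (M : Fin k → ℕ) (w : Word k n) →
  hasCounts M w ≡ allTrue (λ i → letterCount w i ≡ᵇ M i)
hasCounts≡allTrue M w = foldr-map-allFin _∧_ true (λ i → letterCount w i ≡ᵇ M i)

hasCounts-[] : ∀ {k} (M : Fin k → ℕ) → (∀ i → M i ≡ 0) → hasCounts M [] ≡ true
hasCounts-[] M M≡0 = trans (hasCounts≡allTrue M []) (allTrue-true _ (λ i → cong (0 ≡ᵇ_) (M≡0 i)))

hasCounts-∷-zero : ∀ {k n} (M : Fin k → ℕ) a → M a ≡ 0 → (w : Word k n) → hasCounts M (a ∷ w) ≡ false
hasCounts-∷-zero M a Ma≡0 w = trans (hasCounts≡allTrue M (a ∷ w)) (allTrue-false _ a a-miscounted)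
  where
  a-miscounted : (letterCount (a ∷ w) a ≡ᵇ M a) ≡ false
  a-miscounted with a ≟ a
  ... | yes _ rewrite Ma≡0 = refl
  ... | no a≢a = ⊥-elim (a≢a refl)

hasCounts-∷-suc : ∀ {k n} (M : Fin k → ℕ) a {m} → M a ≡ suc m → (w : Word k n) →
  hasCounts M (a ∷ w) ≡ hasCounts (Vector.updateAt M a pred) w
hasCounts-∷-suc M a {m} Ma≡1+m w = begin
  hasCounts M (a ∷ w)
    ≡⟨ hasCounts≡allTrue M (a ∷ w) ⟩
  allTrue (λ i → letterCount (a ∷ w) i ≡ᵇ M i)
    ≡⟨ allTrue-cong agree ⟩
  allTrue (λ i → letterCount w i ≡ᵇ Vector.updateAt M a pred i)
    ≡⟨ hasCounts≡allTrue _ w ⟨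
  hasCounts (Vector.updateAt M a pred) w ∎
  where
  open ≡-Reasoning
  agree : ∀ i → (letterCount (a ∷ w) i ≡ᵇ M i) ≡ (letterCount w i ≡ᵇ Vector.updateAt M a pred i)
  agree i with i ≟ a
  ... | yes refl rewrite updateAt-updates i {pred} M | Ma≡1+m = refl
  ... | no i≢a rewrite updateAt-minimal i a {pred} M i≢a = refl

sum-updateAt-pred : ∀ {k} (M : Fin k → ℕ) a {m} → M a ≡ suc m → sum M ≡ suc (sum (Vector.updateAt M a pred))
sum-updateAt-pred M zero Ma≡1+m rewrite Ma≡1+m = refl
sum-updateAt-pred {suc k} M (suc a) Ma≡1+m
  rewrite sum-updateAt-pred (M ∘ suc) a Ma≡1+m = +-suc (M zero) _

prod!-updateAt-pred : ∀ {k} (M : Fin k → ℕ) a {m} → M a ≡ suc m →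
  prod (λ i → M i !) ≡ suc m * prod (λ i → Vector.updateAt M a pred i !)
prod!-updateAt-pred M zero {m} Ma≡1+m rewrite Ma≡1+m = *-assoc (suc m) (m !) _
prod!-updateAt-pred {suc k} M (suc a) {m} Ma≡1+m = begin
  M zero ! * prod (λ i → M (suc i) !)
    ≡⟨ cong (M zero ! *_) (prod!-updateAt-pred (M ∘ suc) a Ma≡1+m) ⟩
  M zero ! * (suc m * rest)
    ≡⟨ x∙yz≈y∙xz (M zero !) (suc m) rest ⟩
  suc m * (M zero ! * rest) ∎
  where
  open ≡-Reasoning
  rest = prod (λ i → Vector.updateAt (M ∘ suc) a pred i !)

sum≡0⇒≡0 : ∀ {k} (M : Fin k → ℕ) → sum M ≡ 0 → ∀ i → M i ≡ 0
sum≡0⇒≡0 M ΣM≡0 zero = m+n≡0⇒m≡0 (M zero) ΣM≡0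
sum≡0⇒≡0 M ΣM≡0 (suc i) = sum≡0⇒≡0 (M ∘ suc) (m+n≡0⇒n≡0 (M zero) ΣM≡0) i

totalFixed-[] : ∀ {k} (M : Fin k → ℕ) → sum M ≡ 0 → totalFixed k 0 M * prod (λ i → M i !) ≡ 1
totalFixed-[] {k} M ΣM≡0 = begin
  count (hasCounts M) ([] ∷ []) * prod (λ i → M i !)
    ≡⟨ cong₂ _*_ one-word (prod-cong-≗ (λ i → cong _! (M≡0 i))) ⟩
  1 * prod {k} (λ _ → 1)
    ≡⟨ trans (*-identityˡ _) (prod-replicate-one k) ⟩
  1 ∎
  where
  open ≡-Reasoning
  M≡0 = sum≡0⇒≡0 M ΣM≡0
  one-word : count (hasCounts M) ([] ∷ []) ≡ 1
  one-word rewrite hasCounts-[] M M≡0 = refl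

starting-with*prod!≡ : ∀ k n (M : Fin k → ℕ) a →
  (∀ M′ → sum M′ ≡ n → totalFixed k n M′ * prod (λ i → M′ i !) ≡ n !) → sum M ≡ suc n →
  count (hasCounts M ∘ (a ∷_)) (allWords k n) * prod (λ i → M i !) ≡ M a * n !
starting-with*prod!≡ k n M a multinomial ΣM≡1+n with M a in Ma≡
... | zero = cong (_* prod (λ i → M i !)) (count-false (hasCounts-∷-zero M a Ma≡) (allWords k n))
... | suc m = begin
  count (hasCounts M ∘ (a ∷_)) (allWords k n) * prod (λ i → M i !)
    ≡⟨ cong₂ _*_ (count-cong (hasCounts-∷-suc M a Ma≡) (allWords k n)) (prod!-updateAt-pred M a Ma≡) ⟩
  totalFixed k n M′ * (suc m * ∏M′!)
    ≡⟨ x∙yz≈y∙xz (totalFixed k n M′) (suc m) ∏M′! ⟩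
  suc m * (totalFixed k n M′ * ∏M′!)
    ≡⟨ cong (suc m *_) (multinomial M′ (suc-injective (trans (sym (sum-updateAt-pred M a Ma≡)) ΣM≡1+n))) ⟩
  suc m * n ! ∎
  where
  open ≡-Reasoning
  M′ = Vector.updateAt M a pred
  ∏M′! = prod (λ i → M′ i !)

totalFixed*prod!≡! : ∀ k n (M : Fin k → ℕ) → sum M ≡ n → totalFixed k n M * prod (λ i → M i !) ≡ n !
totalFixed*prod!≡! k zero M ΣM≡0 = totalFixed-[] M ΣM≡0
totalFixed*prod!≡! k (suc n) M ΣM≡1+n = begin
  totalFixed k (suc n) M * ∏M!
    ≡⟨ cong (_* ∏M!) (count-allWords-suc k n (hasCounts M)) ⟩
  sum starting-with * ∏M!
    ≡⟨ *-distribʳ-sum ∏M! starting-with ⟩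
  sum (λ a → starting-with a * ∏M!)
    ≡⟨ sum-cong-≗ (λ a → starting-with*prod!≡ k n M a (totalFixed*prod!≡! k n) ΣM≡1+n) ⟩
  sum (λ a → M a * n !)
    ≡⟨ *-distribʳ-sum (n !) M ⟨
  sum M * n !
    ≡⟨ cong (_* n !) ΣM≡1+n ⟩
  suc n * n ! ∎
  where
  open ≡-Reasoning
  ∏M! = prod (λ i → M i !)
  starting-with : Fin k → ℕ
  starting-with a = count (hasCounts M ∘ (a ∷_)) (allWords k n)

badFixed≤badAll : ∀ k n M (Q : Word k n → Bool) → badFixed k n M Q ≤ badAll k n Q
badFixed≤badAll k n M Q = count-∧≤ (hasCounts M) (not ∘ Q) (allWords k n)

-- The exponential series

-- (1 + x/p)^p ≤ N for every p: a form of e^x ≤ N in which only natural numbers occur.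
ExpLe : ℕ → ℕ → Set
ExpLe x N = ∀ p → (p + x) ^ p ≤ p ^ p * N

expPS≡sum : ∀ x m → expPS x m ≡ sum {suc m} (λ i → (m P′ toℕ i) * x ^ (m ∸ toℕ i))
expPS≡sum x zero = refl
expPS≡sum x (suc m) = begin
  suc m * expPS x m + x ^ suc m
    ≡⟨ +-comm _ (x ^ suc m) ⟩
  x ^ suc m + suc m * expPS x m
    ≡⟨ cong (λ e → x ^ suc m + suc m * e) (expPS≡sum x m) ⟩
  x ^ suc m + suc m * sum {suc m} term
    ≡⟨ cong₂ _+_ (sym (*-identityˡ (x ^ suc m))) (*-distribˡ-sum {suc m} (suc m) term) ⟩
  1 * x ^ suc m + sum {suc m} (λ i → suc m * term i)
    ≡⟨ cong (1 * x ^ suc m +_) (sum-cong-≗ {suc m} λ i → sym (step (toℕ i))) ⟩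
  1 * x ^ suc m + sum {suc m} (λ i → (suc m P′ suc (toℕ i)) * x ^ (m ∸ toℕ i)) ∎
  where
  open ≡-Reasoning
  term : Fin (suc m) → ℕ
  term i = (m P′ toℕ i) * x ^ (m ∸ toℕ i)
  step : ∀ i → (suc m P′ suc i) * x ^ (m ∸ i) ≡ suc m * ((m P′ i) * x ^ (m ∸ i))
  step i = trans (cong (_* x ^ (m ∸ i)) (nP′k≡n[n∸1P′k∸1] (suc m) (suc i))) (*-assoc (suc m) (m P′ i) (x ^ (m ∸ i)))

P′*[n∸k]!≡n! : ∀ n k → k ≤ n → (n P′ k) * (n ∸ k) ! ≡ n !
P′*[n∸k]!≡n! n zero _ = *-identityˡ (n !)
P′*[n∸k]!≡n! (suc n) (suc k) (s≤s k≤n) = begin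
  (suc n P′ suc k) * (n ∸ k) !   ≡⟨ cong (_* (n ∸ k) !) (nP′k≡n[n∸1P′k∸1] (suc n) (suc k)) ⟩
  suc n * (n P′ k) * (n ∸ k) !   ≡⟨ *-assoc (suc n) (n P′ k) ((n ∸ k) !) ⟩
  suc n * ((n P′ k) * (n ∸ k) !) ≡⟨ cong (suc n *_) (P′*[n∸k]!≡n! n k k≤n) ⟩
  suc n * n !                    ∎
  where open ≡-Reasoning

P′≤^ : ∀ n k → n P′ k ≤ n ^ k
P′≤^ n zero = ≤-refl
P′≤^ n (suc k) = *-mono-≤ (m∸n≤m n k) (P′≤^ n k)

P≤^ : ∀ n k → n P k ≤ n ^ k
P≤^ n k with k ≤ᵇ n
... | true = P′≤^ n k
... | false = z≤n

C*[n∸k]!≤^ : ∀ n k → k ≤ n → (n C k) * (n ∸ k) ! ≤ n ^ (n ∸ k)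
C*[n∸k]!≤^ n k k≤n = begin
  (n C k) * j !                         ≡⟨ cong (_* j !) (nCk≡nC[n∸k] k≤n) ⟩
  (n C j) * j !                         ≡⟨ cong (_* j !) (nCk≡nPk/k! (m∸n≤m n k)) ⟩
  ((n P j) / j !) {{j !≢0}} * j !       ≤⟨ m/n*n≤m (n P j) (j !) {{j !≢0}} ⟩
  n P j                                 ≤⟨ P≤^ n j ⟩
  n ^ j                                 ∎
  where
  open ≤-Reasoning
  j = n ∸ k

binomialTerm-bound : ∀ n x k → k ≤ n →
  (n C k) * (n ^ k * x ^ (n ∸ k)) * n ! ≤ n ^ n * ((n P′ k) * x ^ (n ∸ k))
binomialTerm-bound n x k k≤n = begin
  (n C k) * (n ^ k * x ^ j) * n !             ≡⟨ cong ((n C k) * (n ^ k * x ^ j) *_) (sym (P′*[n∸k]!≡n! n k k≤n)) ⟩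
  (n C k) * (n ^ k * x ^ j) * ((n P′ k) * j !) ≡⟨ regroup (n C k) (n ^ k) (x ^ j) (n P′ k) (j !) ⟩
  ((n C k) * j !) * (n ^ k * ((n P′ k) * x ^ j)) ≤⟨ *-monoˡ-≤ _ (C*[n∸k]!≤^ n k k≤n) ⟩
  n ^ j * (n ^ k * ((n P′ k) * x ^ j))       ≡⟨ sym (*-assoc (n ^ j) (n ^ k) _) ⟩
  n ^ j * n ^ k * ((n P′ k) * x ^ j)         ≡⟨ cong (_* ((n P′ k) * x ^ j)) (sym (^-distribˡ-+-* n j k)) ⟩
  n ^ (j + k) * ((n P′ k) * x ^ j)           ≡⟨ cong (λ e → n ^ e * ((n P′ k) * x ^ j)) (m∸n+n≡m k≤n) ⟩
  n ^ n * ((n P′ k) * x ^ j)                 ∎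
  where
  open ≤-Reasoning
  j = n ∸ k
  regroup : ∀ a b c d e → a * (b * c) * (d * e) ≡ (a * e) * (b * (d * c))
  regroup = solve-∀

[n+x]^n*n!≤n^n*expPS : ∀ x n → (n + x) ^ n * n ! ≤ n ^ n * expPS x n
[n+x]^n*n!≤n^n*expPS x n = begin
  (n + x) ^ n * n !
    ≡⟨ cong (_* n !) (trans (sym (^ᴿ≡^ (n + x) n)) (Binomial.theorem +-*-commutativeSemiring n n x)) ⟩
  sum {suc n} binomialTerm * n !
    ≡⟨ *-distribʳ-sum {suc n} (n !) binomialTerm ⟩
  sum {suc n} (λ k → binomialTerm k * n !)
    ≤⟨ sum-mono-≤ {suc n} termBound ⟩
  sum {suc n} (λ k → n ^ n * ((n P′ toℕ k) * x ^ (n ∸ toℕ k)))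
    ≡⟨ sym (*-distribˡ-sum {suc n} (n ^ n) (λ k → (n P′ toℕ k) * x ^ (n ∸ toℕ k))) ⟩
  n ^ n * sum {suc n} (λ k → (n P′ toℕ k) * x ^ (n ∸ toℕ k))
    ≡⟨ cong (n ^ n *_) (sym (expPS≡sum x n)) ⟩
  n ^ n * expPS x n ∎
  where
  open ≤-Reasoning
  binomialTerm : Fin (suc n) → ℕ
  binomialTerm k = (n C toℕ k) ×ᴿ (n ^ᴿ toℕ k * x ^ᴿ (n ∸ toℕ k))
  binomialTerm≡ : ∀ k → binomialTerm k ≡ (n C toℕ k) * (n ^ toℕ k * x ^ (n ∸ toℕ k))
  binomialTerm≡ k = trans (×ᴿ≡* (n C toℕ k) _)
    (cong ((n C toℕ k) *_) (cong₂ _*_ (^ᴿ≡^ n (toℕ k)) (^ᴿ≡^ x (n ∸ toℕ k))))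
  termBound : ∀ k → binomialTerm k * n ! ≤ n ^ n * ((n P′ toℕ k) * x ^ (n ∸ toℕ k))
  termBound k rewrite binomialTerm≡ k = binomialTerm-bound n x (toℕ k) (toℕ≤pred[n] k)

LeLog⇒ExpLe : ∀ {x N} → LeLog x N → ExpLe x N
LeLog⇒ExpLe {x} {N} x≤lnN n = *-cancelʳ-≤ _ _ (n !) {{n !≢0}} (begin
  (n + x) ^ n * n ! ≤⟨ [n+x]^n*n!≤n^n*expPS x n ⟩
  n ^ n * expPS x n ≤⟨ *-monoʳ-≤ (n ^ n) (x≤lnN n) ⟩
  n ^ n * (n ! * N) ≡⟨ x*[y*z]≡x*z*y (n ^ n) (n !) N ⟩
  n ^ n * N * n !   ∎)
  where
  open ≤-Reasoning
  x*[y*z]≡x*z*y : ∀ a b c → a * (b * c) ≡ a * c * b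
  x*[y*z]≡x*z*y = solve-∀

ExpLe-antimonoˡ : ∀ {x y N} → x ≤ y → ExpLe y N → ExpLe x N
ExpLe-antimonoˡ x≤y e^y≤N p = ≤-trans (^-monoˡ-≤ p (+-monoʳ-≤ p x≤y)) (e^y≤N p)

ExpLe⇒^≤ : ∀ {x N} → ExpLe x N → ∀ {p a m} → p * a ≤ m * (p + x) → a ^ p ≤ m ^ p * N
ExpLe⇒^≤ {x} {N} e^x≤N {p} {a} {m} pa≤m[p+x] = *-cancelˡ-≤ (p ^ p) {{n^n≢0 p}} (begin
  p ^ p * a ^ p         ≡⟨ *-distrib-^ p a p ⟨
  (p * a) ^ p           ≤⟨ ^-monoˡ-≤ p pa≤m[p+x] ⟩
  (m * (p + x)) ^ p     ≡⟨ *-distrib-^ m (p + x) p ⟩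
  m ^ p * (p + x) ^ p   ≤⟨ *-monoʳ-≤ (m ^ p) (e^x≤N p) ⟩
  m ^ p * (p ^ p * N)   ≡⟨ x∙yz≈y∙xz (m ^ p) (p ^ p) N ⟩
  p ^ p * (m ^ p * N)   ∎)
  where open ≤-Reasoning

-- (1 + u/N)^(2u) ≤ N, from (1 + u/N)^(2uN) ≤ e^(2u²) ≤ e^(3u²) ≤ N^N.
[N+u]^2u≤N^2u*N : ∀ {N u} {{_ : NonZero N}} → ExpLe (3 * u ²) (N ^ N) →
  (N + u) ^ (2 * u) ≤ N ^ (2 * u) * N
[N+u]^2u≤N^2u*N {N} {u} e^3u²≤N^N = ^*-cancel (2 * u) N (ExpLe⇒^≤ e^3u²≤N^N {2 * u * N} {N + u} {N} (begin
  2 * u * N * (N + u)                     ≤⟨ m≤m+n _ (u * u * N) ⟩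
  2 * u * N * (N + u) + u * u * N         ≡⟨ expand N u ⟩
  N * (2 * u * N + 3 * (u * u))           ∎))
  where
  open ≤-Reasoning
  expand : ∀ N u → 2 * u * N * (N + u) + u * u * N ≡ N * (2 * u * N + 3 * (u * u))
  expand = solve-∀

-- (1 + v/W)^(2v) ≤ W + v, from (1 + v/W)^(2v(W+v)) ≤ e^(3v²) ≤ (W+v)^(W+v) when 2v ≤ W.
[W+v]^2v≤W^2v*[W+v] : ∀ {W v} {{_ : NonZero W}} → 2 * v ≤ W → ExpLe (3 * v ²) ((W + v) ^ (W + v)) →
  (W + v) ^ (2 * v) ≤ W ^ (2 * v) * (W + v)
[W+v]^2v≤W^2v*[W+v] {W} {v} 2v≤W e^3v²≤N^N with m≤n⇒∃[o]m+o≡n 2v≤W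
... | t , refl = ^*-cancel (2 * v) N {{>-nonZero (<-≤-trans (>-nonZero⁻¹ W) (m≤m+n W v))}}
  (ExpLe⇒^≤ e^3v²≤N^N {2 * v * N} {N} {W} (begin
    2 * v * N * N                         ≤⟨ m≤m+n _ (v * v * t) ⟩
    2 * v * N * N + v * v * t             ≡⟨ expand v t ⟩
    W * (2 * v * N + 3 * (v * v))         ∎))
  where
  open ≤-Reasoning
  N = W + v
  expand : ∀ v t → 2 * v * (2 * v + t + v) * (2 * v + t + v) + v * v * t
                 ≡ (2 * v + t) * (2 * v * (2 * v + t + v) + 3 * (v * v))
  expand = solve-∀

3^n*n<4^n : ∀ n → 7 ≤ n → 3 ^ n * n < 4 ^ n
3^n*n<4^n n 7≤n with m≤n⇒∃[o]m+o≡n 7≤n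
... | d , refl = go d
  where
  go : ∀ d → 3 ^ (7 + d) * (7 + d) < 4 ^ (7 + d)
  go zero = ≤ᵇ⇒≤ 15310 16384 tt
  go (suc d) = begin-strict
    3 * 3 ^ (7 + d) * (8 + d)   ≤⟨ ≤-trans (m≤m+n _ (3 ^ (7 + d) * (4 + d))) (≤-reflexive (regroup (3 ^ (7 + d)) d)) ⟩
    4 * (3 ^ (7 + d) * (7 + d)) <⟨ *-monoʳ-< 4 (go d) ⟩
    4 * 4 ^ (7 + d)             ∎
    where
    open ≤-Reasoning
    regroup : ∀ a d → 3 * a * (8 + d) + a * (4 + d) ≡ 4 * (a * (7 + d))
    regroup = solve-∀

-- The deviation u is small: e^(3u²) ≤ n^n forces 3u < n, since otherwise (1 + 3u²/n²)^(n²) ≥ (4/3)^(n²).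
3u<n : ∀ {n u} → 7 ≤ n → ExpLe (3 * u ²) (n ^ n) → 3 * u < n
3u<n {n} {u} 7≤n e^3u²≤n^n with 3 * u <? n
... | yes 3u<n = 3u<n
... | no 3u≮n = contradiction (^*-cancel {4} {3} {n} n n {{nz}} (ExpLe⇒^≤ e^3u²≤n^n {n * n} {4} {3} (begin
  n * n * 4                   ≡⟨ *-comm (n * n) 4 ⟩
  4 * (n * n)                 ≡⟨ split (n * n) ⟩
  3 * (n * n) + n * n         ≤⟨ +-monoʳ-≤ (3 * (n * n)) (*-mono-≤ n≤3u n≤3u) ⟩
  3 * (n * n) + 3 * u * (3 * u) ≡⟨ collect (n * n) u ⟩
  3 * (n * n + 3 * (u * u))   ∎))) (<⇒≱ (3^n*n<4^n n 7≤n))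
  where
  open ≤-Reasoning
  nz : NonZero n
  nz = >-nonZero (≤-trans (s≤s z≤n) 7≤n)
  n≤3u : n ≤ 3 * u
  n≤3u = ≮⇒≥ 3u≮n
  split : ∀ x → 4 * x ≡ 3 * x + x
  split = solve-∀
  collect : ∀ x u → 3 * x + 3 * u * (3 * u) ≡ 3 * (x + 3 * (u * u))
  collect = solve-∀

-- Comparing a letter count with a balanced one

[m+d]!≤m!*[m+d]^d : ∀ m d → (m + d) ! ≤ m ! * (m + d) ^ d
[m+d]!≤m!*[m+d]^d m zero rewrite +-identityʳ m = ≤-reflexive (sym (*-identityʳ (m !)))
[m+d]!≤m!*[m+d]^d m (suc d) rewrite +-suc m d = begin
  suc (m + d) * (m + d) !                   ≤⟨ *-monoʳ-≤ (suc (m + d)) ([m+d]!≤m!*[m+d]^d m d) ⟩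
  suc (m + d) * (m ! * (m + d) ^ d)         ≤⟨ *-monoʳ-≤ (suc (m + d)) (*-monoʳ-≤ (m !) (^-monoˡ-≤ d (n≤1+n (m + d)))) ⟩
  suc (m + d) * (m ! * suc (m + d) ^ d)     ≡⟨ x∙yz≈y∙xz (suc (m + d)) (m !) _ ⟩
  m ! * suc (m + d) ^ suc d                 ∎
  where open ≤-Reasoning

m!*[1+m]^d≤[m+d]! : ∀ m d → m ! * suc m ^ d ≤ (m + d) !
m!*[1+m]^d≤[m+d]! m zero rewrite +-identityʳ m = ≤-reflexive (*-identityʳ (m !))
m!*[1+m]^d≤[m+d]! m (suc d) rewrite +-suc m d = begin
  m ! * (suc m * suc m ^ d)    ≡⟨ x∙yz≈y∙xz (m !) (suc m) _ ⟩
  suc m * (m ! * suc m ^ d)    ≤⟨ *-mono-≤ (s≤s (m≤m+n m d)) (m!*[1+m]^d≤[m+d]! m d) ⟩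
  suc (m + d) * (m + d) !      ∎
  where open ≤-Reasoning

d*2k≤2v+4k : ∀ {k d v} → k * d ≤ v + 2 * k → d * (2 * k) ≤ 2 * v + 4 * k
d*2k≤2v+4k {k} {d} {v} kd≤v+2k = begin
  d * (2 * k)       ≡⟨ double-swap d k ⟩
  2 * (k * d)       ≤⟨ *-monoʳ-≤ 2 kd≤v+2k ⟩
  2 * (v + 2 * k)   ≡⟨ distribute v k ⟩
  2 * v + 4 * k     ∎
  where
  open ≤-Reasoning
  double-swap : ∀ d k → d * (2 * k) ≡ 2 * (k * d)
  double-swap = solve-∀
  distribute : ∀ v k → 2 * (v + 2 * k) ≡ 2 * v + 4 * k
  distribute = solve-∀

m!*m^d≤[m+d]! : ∀ m d → m ! * m ^ d ≤ (m + d) !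
m!*m^d≤[m+d]! m d = ≤-trans (*-monoʳ-≤ (m !) (^-monoˡ-≤ d (n≤1+n m))) (m!*[1+m]^d≤[m+d]! m d)

[k[B+d]]^d≤N^d : ∀ {k N B d u} {{_ : NonZero N}} → ∣ k * (B + d) - N ∣ ≤ u → 3 * u < N →
  ExpLe (3 * u ²) (N ^ N) → N < k * B + k →
  (k * (B + d)) ^ (d * (2 * k)) ≤ N ^ (d * (2 * k)) * (N * 2 ^ (4 * k))
[k[B+d]]^d≤N^d {k} {N} {B} {d} {u} {{N≢0}} dev 3u<N e^3u²≤N^N N<kB+k =
  ^-ratio-bound {{N≢0}} {{m*n≢0 N (2 ^ (4 * k)) {{N≢0}} {{m^n≢0 2 (4 * k)}}}} (d * (2 * k)) (2 * u) (4 * k)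
    (d*2k≤2v+4k {k} {d} {u} (≤-trans kd≤u+k (+-monoʳ-≤ u (m≤n*m k 2))))
    (≤-trans (^-monoˡ-≤ (2 * u) kM≤N+u) ([N+u]^2u≤N^2u*N {N} {u} e^3u²≤N^N))
    (^-≤-double (4 * k) (x≤y+z⇒z≤y⇒x≤2y kM≤N+u (≤-trans (m≤n*m u 3) (<⇒≤ 3u<N))))
  where
  kM≤N+u : k * (B + d) ≤ N + u
  kM≤N+u = ∣m-n∣≤u⇒m≤n+u dev
  kd≤u+k : k * d ≤ u + k
  kd≤u+k = +-cancelˡ-≤ N _ _ (≤-pred (begin
    suc N + k * d             ≤⟨ +-monoˡ-≤ (k * d) N<kB+k ⟩
    k * B + k + k * d         ≡⟨ regroup k B d ⟩
    k * (B + d) + k           ≤⟨ +-monoˡ-≤ k kM≤N+u ⟩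
    N + u + k                 ≤⟨ ≤-trans (≤-reflexive (+-assoc N u k)) (n≤1+n _) ⟩
    suc (N + (u + k))         ∎))
    where
    open ≤-Reasoning
    regroup : ∀ k B d → k * B + k + k * d ≡ k * (B + d) + k
    regroup = solve-∀

N^2v≤W^2v*N : ∀ {N W} {{_ : NonZero N}} {{_ : NonZero W}} → 2 * (N ∸ W) ≤ W →
  ExpLe (3 * (N ∸ W) ²) (N ^ N) → N ^ (2 * (N ∸ W)) ≤ W ^ (2 * (N ∸ W)) * N
N^2v≤W^2v*N {N} {W} 2v≤W e^3v²≤N^N with ≤-total W N
... | inj₁ W≤N = subst (λ z → z ^ (2 * v) ≤ W ^ (2 * v) * z) W+v≡N
  ([W+v]^2v≤W^2v*[W+v] 2v≤W (subst (λ z → ExpLe (3 * v ²) (z ^ z)) (sym W+v≡N) e^3v²≤N^N))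
  where
  v = N ∸ W
  W+v≡N = m+[n∸m]≡n W≤N
... | inj₂ N≤W rewrite m≤n⇒m∸n≡0 N≤W = ≤-trans (>-nonZero⁻¹ N) (≤-reflexive (sym (*-identityˡ N)))

N^d≤[k[1+M]]^d : ∀ {k N M d u} {{_ : NonZero k}} {{_ : NonZero N}} → ∣ k * M - N ∣ ≤ u → 3 * u < N →
  ExpLe (3 * u ²) (N ^ N) → k * (M + d) ≤ N + k →
  N ^ (d * (2 * k)) ≤ (k * suc M) ^ (d * (2 * k)) * (N * 2 ^ (4 * k))
N^d≤[k[1+M]]^d {k} {N} {M} {d} {u} {{_}} {{N≢0}} dev 3u<N e^3u²≤N^N k[M+d]≤N+k =
  ^-ratio-bound {{m*n≢0 k (suc M)}} {{m*n≢0 N (2 ^ (4 * k)) {{N≢0}} {{m^n≢0 2 (4 * k)}}}} (d * (2 * k)) (2 * v) (4 * k)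
    (d*2k≤2v+4k {k} {d} {v} kd≤v+2k)
    (N^2v≤W^2v*N {{N≢0}} {{m*n≢0 k (suc M)}} 2v≤W (ExpLe-antimonoˡ (*-monoʳ-≤ 3 (*-mono-≤ v≤u v≤u)) e^3u²≤N^N))
    (^-≤-double (4 * k) (x≤y+z⇒z≤y⇒x≤2y N≤W+v (≤-trans (m≤n*m v 2) 2v≤W)))
  where
  W = k * suc M
  v = N ∸ W
  W≡kM+k : W ≡ k * M + k
  W≡kM+k = trans (*-suc k M) (+-comm k (k * M))
  N≤W+v : N ≤ W + v
  N≤W+v = m≤n+m∸n N W
  v≤u : v ≤ u
  v≤u = begin
    N ∸ W            ≤⟨ ∸-monoʳ-≤ N (≤-trans (m≤m+n (k * M) k) (≤-reflexive (sym W≡kM+k))) ⟩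
    N ∸ k * M        ≤⟨ m∸n≤∣m-n∣ N (k * M) ⟩
    ∣ N - k * M ∣    ≡⟨ ∣-∣-comm N (k * M) ⟩
    ∣ k * M - N ∣    ≤⟨ dev ⟩
    u                ∎
    where open ≤-Reasoning
  2v≤W : 2 * v ≤ W
  2v≤W = <⇒≤ (+-cancelʳ-< v (2 * v) W (begin-strict
    2 * v + v        ≡⟨ thrice v ⟩
    3 * v            ≤⟨ *-monoʳ-≤ 3 v≤u ⟩
    3 * u            <⟨ 3u<N ⟩
    N                ≤⟨ N≤W+v ⟩
    W + v            ∎))
    where
    open ≤-Reasoning
    thrice : ∀ v → 2 * v + v ≡ 3 * v
    thrice = solve-∀
  kd≤v+2k : k * d ≤ v + 2 * k
  kd≤v+2k = +-cancelˡ-≤ (k * M) _ _ (begin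
    k * M + k * d       ≡⟨ *-distribˡ-+ k M d ⟨
    k * (M + d)         ≤⟨ k[M+d]≤N+k ⟩
    N + k               ≤⟨ +-monoˡ-≤ k N≤W+v ⟩
    W + v + k           ≡⟨ cong (λ z → z + v + k) W≡kM+k ⟩
    k * M + k + v + k   ≡⟨ regroup (k * M) k v ⟩
    k * M + (v + 2 * k) ∎)
    where
    open ≤-Reasoning
    regroup : ∀ a k v → a + k + v + k ≡ a + (v + 2 * k)
    regroup = solve-∀

letter-factor-bound-above : ∀ {k N B d u} {{_ : NonZero N}} → ∣ k * (B + d) - N ∣ ≤ u → 3 * u < N →
  ExpLe (3 * u ²) (N ^ N) → N < k * B + k →
  ((B + d) ! * k ^ (B + d) * N ^ B) ^ (2 * k) ≤ (B ! * k ^ B * N ^ (B + d)) ^ (2 * k) * (N * 2 ^ (4 * k))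
letter-factor-bound-above {k} {N} {B} {d} dev 3u<N e^3u²≤N^N N<kB+k = begin
  ((B + d) ! * k ^ (B + d) * N ^ B) ^ (2 * k)
    ≤⟨ ^-monoˡ-≤ (2 * k) above ⟩
  (Z * (k * (B + d)) ^ d) ^ (2 * k)
    ≤⟨ *-^-bound Z (2 * k) (^^-bound d (2 * k) ([k[B+d]]^d≤N^d {k} {N} {B} {d} dev 3u<N e^3u²≤N^N N<kB+k)) ⟩
  (Z * N ^ d) ^ (2 * k) * c
    ≡⟨ cong (λ z → z ^ (2 * k) * c) (x*y^m*y^n≡x*y^[m+n] (B ! * k ^ B) N B d) ⟩
  (B ! * k ^ B * N ^ (B + d)) ^ (2 * k) * c ∎
  where
  open ≤-Reasoning
  Z = B ! * k ^ B * N ^ B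
  c = N * 2 ^ (4 * k)
  above : (B + d) ! * k ^ (B + d) * N ^ B ≤ Z * (k * (B + d)) ^ d
  above = begin
    (B + d) ! * k ^ (B + d) * N ^ B                 ≤⟨ *-monoˡ-≤ (N ^ B) (*-monoˡ-≤ (k ^ (B + d)) ([m+d]!≤m!*[m+d]^d B d)) ⟩
    B ! * (B + d) ^ d * k ^ (B + d) * N ^ B          ≡⟨ cong (λ z → B ! * (B + d) ^ d * z * N ^ B) (^-distribˡ-+-* k B d) ⟩
    B ! * (B + d) ^ d * (k ^ B * k ^ d) * N ^ B      ≡⟨ shuffle (B !) ((B + d) ^ d) (k ^ B) (k ^ d) (N ^ B) ⟩
    Z * (k ^ d * (B + d) ^ d)                        ≡⟨ cong (Z *_) (*-distrib-^ k (B + d) d) ⟨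
    Z * (k * (B + d)) ^ d                            ∎
    where
    shuffle : ∀ f p q r s → f * p * (q * r) * s ≡ f * q * s * (r * p)
    shuffle = solve-∀

letter-factor-bound-below : ∀ {k N M d u} {{_ : NonZero k}} {{_ : NonZero N}} → ∣ k * M - N ∣ ≤ u → 3 * u < N →
  ExpLe (3 * u ²) (N ^ N) → k * (M + d) ≤ N + k →
  (M ! * k ^ M * N ^ (M + d)) ^ (2 * k) ≤ ((M + d) ! * k ^ (M + d) * N ^ M) ^ (2 * k) * (N * 2 ^ (4 * k))
letter-factor-bound-below {k} {N} {M} {d} dev 3u<N e^3u²≤N^N k[M+d]≤N+k = begin
  (M ! * k ^ M * N ^ (M + d)) ^ (2 * k)
    ≡⟨ cong (_^ (2 * k)) (x*y^m*y^n≡x*y^[m+n] (M ! * k ^ M) N M d) ⟨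
  (Z * N ^ d) ^ (2 * k)
    ≤⟨ *-^-bound Z (2 * k) (^^-bound d (2 * k) (N^d≤[k[1+M]]^d {k} {N} {M} {d} dev 3u<N e^3u²≤N^N k[M+d]≤N+k)) ⟩
  (Z * (k * suc M) ^ d) ^ (2 * k) * c
    ≤⟨ *-monoˡ-≤ c (^-monoˡ-≤ (2 * k) below) ⟩
  ((M + d) ! * k ^ (M + d) * N ^ M) ^ (2 * k) * c ∎
  where
  open ≤-Reasoning
  Z = M ! * k ^ M * N ^ M
  c = N * 2 ^ (4 * k)
  below : Z * (k * suc M) ^ d ≤ (M + d) ! * k ^ (M + d) * N ^ M
  below = begin
    Z * (k * suc M) ^ d                          ≡⟨ cong (Z *_) (*-distrib-^ k (suc M) d) ⟩
    Z * (k ^ d * suc M ^ d)                      ≡⟨ shuffle (M !) (k ^ M) (N ^ M) (k ^ d) (suc M ^ d) ⟩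
    M ! * suc M ^ d * (k ^ M * k ^ d) * N ^ M    ≡⟨ cong (λ z → M ! * suc M ^ d * z * N ^ M) (^-distribˡ-+-* k M d) ⟨
    M ! * suc M ^ d * k ^ (M + d) * N ^ M        ≤⟨ *-monoˡ-≤ (N ^ M) (*-monoˡ-≤ (k ^ (M + d)) (m!*[1+m]^d≤[m+d]! M d)) ⟩
    (M + d) ! * k ^ (M + d) * N ^ M              ∎
    where
    shuffle : ∀ f q s r p → f * q * s * (r * p) ≡ f * p * (q * r) * s
    shuffle = solve-∀

-- M! (k/N)^M ≤ B! (k/N)^B (2^(4k) N)^(1/2k) for a balanced count B, cleared of roots and fractions.
letter-factor-bound : ∀ {k N M B u} {{_ : NonZero k}} {{_ : NonZero N}} → ∣ k * M - N ∣ ≤ u → 3 * u < N →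
  ExpLe (3 * u ²) (N ^ N) → N < k * B + k → k * B ≤ N + k →
  (M ! * k ^ M * N ^ B) ^ (2 * k) ≤ (B ! * k ^ B * N ^ M) ^ (2 * k) * (N * 2 ^ (4 * k))
letter-factor-bound {k} {N} {M} {B} dev 3u<N e^3u²≤N^N N<kB+k kB≤N+k with ≤-total B M
... | inj₁ B≤M with d , refl ← m≤n⇒∃[o]m+o≡n B≤M = letter-factor-bound-above {k} {N} {B} {d} dev 3u<N e^3u²≤N^N N<kB+k
... | inj₂ M≤B with d , refl ← m≤n⇒∃[o]m+o≡n M≤B = letter-factor-bound-below {k} {N} {M} {d} dev 3u<N e^3u²≤N^N kB≤N+k

-- The central multinomial coefficient

rising : ℕ → ℕ → ℕ
rising c zero = 1
rising c (suc m) = suc c * rising (suc c) m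

[c+m]!≡c!*rising : ∀ c m → (c + m) ! ≡ c ! * rising c m
[c+m]!≡c!*rising c zero = trans (cong _! (+-identityʳ c)) (sym (*-identityʳ (c !)))
[c+m]!≡c!*rising c (suc m) = begin
  (c + suc m) !                       ≡⟨ cong _! (+-suc c m) ⟩
  (suc c + m) !                       ≡⟨ [c+m]!≡c!*rising (suc c) m ⟩
  suc c * c ! * rising (suc c) m      ≡⟨ cong (_* rising (suc c) m) (*-comm (suc c) (c !)) ⟩
  c ! * suc c * rising (suc c) m      ≡⟨ *-assoc (c !) (suc c) _ ⟩
  c ! * (suc c * rising (suc c) m)    ∎
  where open ≡-Reasoning

c^[1+m]*[c+2+m]≤[1+c]^[2+m] : ∀ c m → c ^ suc m * (c + suc (suc m)) ≤ suc c ^ suc (suc m)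
c^[1+m]*[c+2+m]≤[1+c]^[2+m] c zero = ≤-trans (m≤m+n _ 1) (≤-reflexive (square c))
  where
  square : ∀ c → c * 1 * (c + 2) + 1 ≡ (1 + c) * ((1 + c) * 1)
  square = solve-∀
c^[1+m]*[c+2+m]≤[1+c]^[2+m] c (suc m) = begin
  c * x * (c + suc (suc (suc m)))
    ≡⟨ expand c x m ⟩
  c * (x * (c + suc (suc m))) + c * x
    ≤⟨ +-mono-≤ (*-monoʳ-≤ c (c^[1+m]*[c+2+m]≤[1+c]^[2+m] c m)) (^-monoˡ-≤ (suc (suc m)) (n≤1+n c)) ⟩
  c * y + y
    ≡⟨ +-comm (c * y) y ⟩
  suc c * y ∎
  where
  open ≤-Reasoning
  x = c ^ suc m
  y = suc c ^ suc (suc m)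
  expand : ∀ c x m → c * x * (c + (3 + m)) ≡ c * (x * (c + (2 + m))) + c * x
  expand = solve-∀

[c[c+1+m]]^m≤rising² : ∀ c m → (c * (c + suc m)) ^ m ≤ rising c m ²
[c[c+1+m]]^m≤rising² c zero = ≤-refl
[c[c+1+m]]^m≤rising² c (suc m) = begin
  (c * b) ^ suc m                          ≡⟨ *-distrib-^ c b (suc m) ⟩
  c ^ suc m * (b * b ^ m)                  ≡⟨ *-assoc (c ^ suc m) b (b ^ m) ⟨
  c ^ suc m * b * b ^ m                    ≤⟨ *-monoˡ-≤ (b ^ m) (c^[1+m]*[c+2+m]≤[1+c]^[2+m] c m) ⟩
  suc c ^ suc (suc m) * b ^ m              ≡⟨ *-assoc (suc c) (suc c ^ suc m) (b ^ m) ⟩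
  suc c * (suc c * suc c ^ m * b ^ m)      ≡⟨ cong (suc c *_) (*-assoc (suc c) (suc c ^ m) (b ^ m)) ⟩
  suc c * (suc c * (suc c ^ m * b ^ m))    ≡⟨ cong (λ z → suc c * (suc c * z)) (*-distrib-^ (suc c) b m) ⟨
  suc c * (suc c * (suc c * b) ^ m)        ≡⟨ cong (λ z → suc c * (suc c * (suc c * z) ^ m)) (+-suc c (suc m)) ⟩
  suc c * (suc c * (suc c * (suc c + suc m)) ^ m) ≤⟨ *-monoʳ-≤ (suc c) (*-monoʳ-≤ (suc c) ([c[c+1+m]]^m≤rising² (suc c) m)) ⟩
  suc c * (suc c * rising (suc c) m ²)     ≡⟨ *-assoc (suc c) (suc c) _ ⟨
  suc c ² * rising (suc c) m ²             ≡⟨ *-distrib-² (suc c) (rising (suc c) m) ⟨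
  rising c (suc m) ²                       ∎
  where
  open ≤-Reasoning
  b = c + suc (suc m)

module _ (m : ℕ) where

  private
    k = suc m

  k*[1+q]≡k*q+k : ∀ q → k * suc q ≡ k * q + k
  k*[1+q]≡k*q+k q = trans (*-suc k q) (+-comm k (k * q))

  central-factor-step : ∀ q → k ^ (k * suc q) * (suc q !) ^ k ≡ k ^ (k * q) * (q !) ^ k * (k * suc q) ^ k
  central-factor-step q = begin
    k ^ (k * suc q) * (suc q * q !) ^ k
      ≡⟨ cong₂ _*_ (trans (cong (k ^_) (k*[1+q]≡k*q+k q)) (^-distribˡ-+-* k (k * q) k)) (*-distrib-^ (suc q) (q !) k) ⟩
    k ^ (k * q) * k ^ k * (suc q ^ k * (q !) ^ k)
      ≡⟨ shuffle (k ^ (k * q)) (k ^ k) (suc q ^ k) ((q !) ^ k) ⟩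
    k ^ (k * q) * (q !) ^ k * (k ^ k * suc q ^ k)
      ≡⟨ cong (k ^ (k * q) * (q !) ^ k *_) (*-distrib-^ k (suc q) k) ⟨
    k ^ (k * q) * (q !) ^ k * (k * suc q) ^ k ∎
    where
    open ≡-Reasoning
    shuffle : ∀ a b c d → a * b * (c * d) ≡ a * d * (b * c)
    shuffle = solve-∀

  central-step : ∀ q → ((k * q) !) ² * q ^ m * ((k * suc q) ^ k) ² ≤ ((k * suc q) !) ² * suc q ^ m
  central-step q = begin
    (c !) ² * q ^ m * (A * A ^ m) ²
      ≡⟨ regroup (c !) (q ^ m) A (A ^ m) ⟩
    (A * c !) ² * (q ^ m * (A ^ m * A ^ m))
      ≡⟨ cong (λ z → (A * c !) ² * (q ^ m * z)) (*-distrib-^ A A m) ⟨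
    (A * c !) ² * (q ^ m * (A * A) ^ m)
      ≡⟨ cong ((A * c !) ² *_) (*-distrib-^ q (A * A) m) ⟨
    (A * c !) ² * (q * (A * A)) ^ m
      ≡⟨ cong (λ z → (A * c !) ² * z ^ m) (pair-up k q) ⟩
    (A * c !) ² * (c * A * suc q) ^ m
      ≡⟨ cong ((A * c !) ² *_) (*-distrib-^ (c * A) (suc q) m) ⟩
    (A * c !) ² * ((c * A) ^ m * suc q ^ m)
      ≤⟨ *-monoʳ-≤ ((A * c !) ²) (*-monoˡ-≤ (suc q ^ m) [cA]^m≤rising²) ⟩
    (A * c !) ² * (rising c m ² * suc q ^ m)
      ≡⟨ *-assoc ((A * c !) ²) _ _ ⟨
    (A * c !) ² * rising c m ² * suc q ^ m
      ≡⟨ cong (_* suc q ^ m) (*-distrib-² (A * c !) (rising c m)) ⟨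
    (A * c ! * rising c m) ² * suc q ^ m
      ≡⟨ cong (λ z → z ² * suc q ^ m) A!≡ ⟨
    (A !) ² * suc q ^ m ∎
    where
    open ≤-Reasoning
    c = k * q
    A = k * suc q
    regroup : ∀ f p a b → f * f * p * ((a * b) * (a * b)) ≡ (a * f) * (a * f) * (p * (b * b))
    regroup = solve-∀
    pair-up : ∀ k q → q * (k * (1 + q) * (k * (1 + q))) ≡ k * q * (k * (1 + q)) * (1 + q)
    pair-up = solve-∀
    [cA]^m≤rising² : (c * A) ^ m ≤ rising c m ²
    [cA]^m≤rising² = subst (λ z → (c * z) ^ m ≤ rising c m ²) (sym (k*[1+q]≡k*q+k q)) ([c[c+1+m]]^m≤rising² c m)
    A!≡ : A ! ≡ A * c ! * rising c m
    A!≡ = begin-equality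
      A !                           ≡⟨ cong _! (trans (k*[1+q]≡k*q+k q) (+-suc c m)) ⟩
      suc (c + m) * (c + m) !       ≡⟨ cong₂ _*_ (sym (trans (k*[1+q]≡k*q+k q) (+-suc c m))) ([c+m]!≡c!*rising c m) ⟩
      A * (c ! * rising c m)        ≡⟨ *-assoc A (c !) (rising c m) ⟨
      A * c ! * rising c m          ∎

  -- (kq)!/(q!)^k ≥ k^(kq) / (k^k q^((k-1)/2)), squared so that the exponent of q is an integer.
  central-bound : ∀ q → (k ^ (k * suc q) * (suc q !) ^ k) ² ≤ (k ^ k) ² * (((k * suc q) !) ² * suc q ^ m)
  central-bound zero = begin
    (k ^ (k * 1) * 1 ^ k) ²          ≡⟨ cong _² (cong₂ _*_ (cong (k ^_) (*-identityʳ k)) (^-zeroˡ k)) ⟩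
    (k ^ k * 1) ²                    ≡⟨ cong _² (*-identityʳ (k ^ k)) ⟩
    (k ^ k) ²                        ≤⟨ m≤m*n ((k ^ k) ²) (((k * 1) !) ² * 1 ^ m) {{positive}} ⟩
    (k ^ k) ² * (((k * 1) !) ² * 1 ^ m) ∎
    where
    open ≤-Reasoning
    positive : NonZero (((k * 1) !) ² * 1 ^ m)
    positive = m*n≢0 _ _ {{m*n≢0 _ _ {{(k * 1) !≢0}} {{(k * 1) !≢0}}}} {{m^n≢0 1 m}}
  central-bound (suc q) = begin
    (k ^ (k * suc (suc q)) * (suc (suc q) !) ^ k) ²          ≡⟨ cong _² (central-factor-step (suc q)) ⟩
    (F * (k * suc (suc q)) ^ k) ²                            ≡⟨ *-distrib-² F _ ⟩
    F ² * ((k * suc (suc q)) ^ k) ²                          ≤⟨ *-monoˡ-≤ _ (central-bound q) ⟩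
    (k ^ k) ² * Y * ((k * suc (suc q)) ^ k) ²                ≡⟨ *-assoc ((k ^ k) ²) Y _ ⟩
    (k ^ k) ² * (Y * ((k * suc (suc q)) ^ k) ²)              ≤⟨ *-monoʳ-≤ ((k ^ k) ²) (central-step (suc q)) ⟩
    (k ^ k) ² * (((k * suc (suc q)) !) ² * suc (suc q) ^ m)  ∎
    where
    open ≤-Reasoning
    F = k ^ (k * suc q) * (suc q !) ^ k
    Y = ((k * suc q) !) ² * suc q ^ m

  central-bound-with-remainder : ∀ q r → r ≤ k →
    (k ^ (k * suc q + r) * ((suc q !) ^ k * suc (suc q) ^ r)) ² ≤ (k ^ k) ² * (2 ^ k) ² * (((k * suc q + r) !) ² * suc q ^ m)
  central-bound-with-remainder q r r≤k = begin
    (k ^ (c + r) * ((Q !) ^ k * suc Q ^ r)) ²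
      ≡⟨ cong _² split ⟩
    (F * (k * suc Q) ^ r) ²
      ≤⟨ ²-mono-≤ (*-monoʳ-≤ F (^-monoˡ-≤ r k[1+Q]≤2c)) ⟩
    (F * (2 * c) ^ r) ²
      ≡⟨ cong (λ z → (F * z) ²) (*-distrib-^ 2 c r) ⟩
    (F * (2 ^ r * c ^ r)) ²
      ≡⟨ trans (*-distrib-² F _) (cong (F ² *_) (*-distrib-² (2 ^ r) (c ^ r))) ⟩
    F ² * ((2 ^ r) ² * (c ^ r) ²)
      ≤⟨ *-monoˡ-≤ _ (central-bound q) ⟩
    (k ^ k) ² * ((c !) ² * Q ^ m) * ((2 ^ r) ² * (c ^ r) ²)
      ≡⟨ regroup ((k ^ k) ²) (c !) (Q ^ m) (2 ^ r) (c ^ r) ⟩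
    (k ^ k) ² * (2 ^ r) ² * ((c ! * c ^ r) ² * Q ^ m)
      ≤⟨ *-mono-≤ (*-monoʳ-≤ ((k ^ k) ²) (²-mono-≤ (^-monoʳ-≤ 2 r≤k)))
                  (*-monoˡ-≤ (Q ^ m) (²-mono-≤ (m!*m^d≤[m+d]! c r))) ⟩
    (k ^ k) ² * (2 ^ k) ² * (((c + r) !) ² * Q ^ m) ∎
    where
    open ≤-Reasoning
    Q = suc q
    c = k * Q
    F = k ^ c * (Q !) ^ k
    split : k ^ (c + r) * ((Q !) ^ k * suc Q ^ r) ≡ F * (k * suc Q) ^ r
    split = begin-equality
      k ^ (c + r) * ((Q !) ^ k * suc Q ^ r)        ≡⟨ cong (_* ((Q !) ^ k * suc Q ^ r)) (^-distribˡ-+-* k c r) ⟩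
      k ^ c * k ^ r * ((Q !) ^ k * suc Q ^ r)      ≡⟨ interchange (k ^ c) (k ^ r) ((Q !) ^ k) (suc Q ^ r) ⟩
      F * (k ^ r * suc Q ^ r)                      ≡⟨ cong (F *_) (*-distrib-^ k (suc Q) r) ⟨
      F * (k * suc Q) ^ r                          ∎
    k[1+Q]≤2c : k * suc Q ≤ 2 * c
    k[1+Q]≤2c = begin
      k * suc Q    ≡⟨ k*[1+q]≡k*q+k Q ⟩
      c + k        ≤⟨ +-monoʳ-≤ c (m≤m*n k Q) ⟩
      c + c        ≡⟨ cong (c +_) (+-identityʳ c) ⟨
      2 * c        ∎
    regroup : ∀ K f p t s → K * (f * f * p) * (t * t * (s * s)) ≡ K * (t * t) * ((f * s) * (f * s) * p)
    regroup = solve-∀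

balanced : ∀ {k} → ℕ → ℕ → Fin k → ℕ
balanced q r i = q + (if toℕ i <ᵇ r then 1 else 0)

sum-balanced : ∀ k q r → r ≤ k → sum (balanced {k} q r) ≡ k * q + r
sum-balanced zero q zero _ = refl
sum-balanced (suc k) q zero _ = begin
  q + 0 + sum (balanced {k} q 0) ≡⟨ cong₂ _+_ (+-identityʳ q) (sum-balanced k q 0 z≤n) ⟩
  q + (k * q + 0)                 ≡⟨ +-assoc q (k * q) 0 ⟨
  q + k * q + 0                   ∎
  where open ≡-Reasoning
sum-balanced (suc k) q (suc r) (s≤s r≤k) = begin
  q + 1 + sum (balanced {k} q r)  ≡⟨ cong (q + 1 +_) (sum-balanced k q r r≤k) ⟩
  q + 1 + (k * q + r)             ≡⟨ regroup q k r ⟩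
  q + k * q + suc r               ∎
  where
  open ≡-Reasoning
  regroup : ∀ q k r → q + 1 + (k * q + r) ≡ q + k * q + (1 + r)
  regroup = solve-∀

prod!-balanced : ∀ k q r → r ≤ k → prod (λ i → balanced {k} q r i !) ≡ (q !) ^ k * suc q ^ r
prod!-balanced zero q zero _ = refl
prod!-balanced (suc k) q zero _ = begin
  (q + 0) ! * prod (λ i → balanced {k} q 0 i !) ≡⟨ cong₂ _*_ (cong _! (+-identityʳ q)) (prod!-balanced k q 0 z≤n) ⟩
  q ! * ((q !) ^ k * 1)                          ≡⟨ *-assoc (q !) ((q !) ^ k) 1 ⟨
  q ! * (q !) ^ k * 1                            ∎
  where open ≡-Reasoning
prod!-balanced (suc k) q (suc r) (s≤s r≤k) = begin
  (q + 1) ! * prod (λ i → balanced {k} q r i !)  ≡⟨ cong₂ _*_ (cong _! (+-comm q 1)) (prod!-balanced k q r r≤k) ⟩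
  suc q * q ! * ((q !) ^ k * suc q ^ r)          ≡⟨ regroup (suc q) (q !) ((q !) ^ k) (suc q ^ r) ⟩
  q ! * (q !) ^ k * (suc q * suc q ^ r)          ∎
  where
  open ≡-Reasoning
  regroup : ∀ a b c d → a * b * (c * d) ≡ b * c * (a * d)
  regroup = solve-∀

k*balanced≤k*q+k : ∀ {k} q r i → k * balanced {k} q r i ≤ k * q + k
k*balanced≤k*q+k {k} q r i = begin
  k * (q + (if toℕ i <ᵇ r then 1 else 0))
    ≡⟨ *-distribˡ-+ k q _ ⟩
  k * q + k * (if toℕ i <ᵇ r then 1 else 0)
    ≤⟨ +-monoʳ-≤ (k * q) (≤-trans (*-monoʳ-≤ k (at-most-one (toℕ i <ᵇ r))) (≤-reflexive (*-identityʳ k))) ⟩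
  k * q + k ∎
  where
  open ≤-Reasoning
  at-most-one : ∀ b → (if b then 1 else 0) ≤ 1
  at-most-one true = ≤-refl
  at-most-one false = z≤n

n<k*balanced+k : ∀ {k n q r} → n ≡ k * q + r → r < k → ∀ i → n < k * balanced {k} q r i + k
n<k*balanced+k {k} {n} {q} {r} n≡kq+r r<k i = begin-strict
  n                        ≡⟨ n≡kq+r ⟩
  k * q + r                <⟨ +-monoʳ-< (k * q) r<k ⟩
  k * q + k                ≤⟨ +-monoˡ-≤ k (*-monoʳ-≤ k (m≤m+n q _)) ⟩
  k * balanced q r i + k   ∎
  where open ≤-Reasoning

k*balanced≤n+k : ∀ {k n q r} → n ≡ k * q + r → ∀ i → k * balanced {k} q r i ≤ n + k
k*balanced≤n+k {k} {n} {q} {r} n≡kq+r i =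
  ≤-trans (k*balanced≤k*q+k q r i) (+-monoˡ-≤ k (≤-trans (m≤m+n (k * q) r) (≤-reflexive (sym n≡kq+r))))

divide-with-positive-quotient : ∀ n k {{_ : NonZero k}} → k ≤ n → Σ ℕ λ q → Σ ℕ λ r → r < k × n ≡ k * suc q + r
divide-with-positive-quotient n k k≤n with n / k | m≡m%n+[m/n]*n n k | m%n<n n k
... | zero | n≡ | n%k<k = contradiction k≤n (<⇒≱ (subst (_< k) (sym (trans n≡ (+-identityʳ (n % k)))) n%k<k))
... | suc q | n≡ | n%k<k = q , n % k , n%k<k , trans n≡ (trans (+-comm (n % k) _) (cong (_+ n % k) (*-comm (suc q) k)))

prod-letter-factors : ∀ {k} (M B : Fin k → ℕ) n →
  prod (λ i → M i ! * k ^ M i * n ^ B i) ≡ prod (λ i → M i !) * (k ^ sum M * n ^ sum B)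
prod-letter-factors {k} M B n = begin
  prod (λ i → M i ! * k ^ M i * n ^ B i)
    ≡⟨ prod-distrib-* (λ i → M i ! * k ^ M i) (λ i → n ^ B i) ⟩
  prod (λ i → M i ! * k ^ M i) * prod (λ i → n ^ B i)
    ≡⟨ cong (_* prod (λ i → n ^ B i)) (prod-distrib-* (λ i → M i !) (λ i → k ^ M i)) ⟩
  prod (λ i → M i !) * prod (λ i → k ^ M i) * prod (λ i → n ^ B i)
    ≡⟨ cong₂ (λ a b → prod (λ i → M i !) * a * b) (prod-^ʳ k M) (prod-^ʳ n B) ⟩
  prod (λ i → M i !) * k ^ sum M * n ^ sum B
    ≡⟨ *-assoc (prod (λ i → M i !)) _ _ ⟩
  prod (λ i → M i !) * (k ^ sum M * n ^ sum B) ∎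
  where open ≡-Reasoning

-- Multiplying the letter-wise bounds, the powers of k and N cancel because both count vectors sum to N.
prod!-bound : ∀ {k N} {{_ : NonZero k}} {{_ : NonZero N}} (M B : Fin k → ℕ) → sum M ≡ N → sum B ≡ N →
  (∀ i → 3 * ∣ k * M i - N ∣ < N) → (∀ i → ExpLe (3 * ∣ k * M i - N ∣ ²) (N ^ N)) →
  (∀ i → N < k * B i + k) → (∀ i → k * B i ≤ N + k) →
  prod (λ i → M i !) ² ≤ prod (λ i → B i !) ² * (N * 2 ^ (4 * k))
prod!-bound {k} {N} M B ΣM≡N ΣB≡N 3u<N e^3u²≤N^N N<kB+k kB≤N+k =
  subst₂ (λ l r → l ≤ r * c) (x^2≡x² ∏M!) (x^2≡x² ∏B!) (^*-cancel 2 k (*-^-cancel G (2 * k) (begin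
    (G * ∏M!) ^ (2 * k)
      ≡⟨ cong (_^ (2 * k)) (letters M B ΣM≡N ΣB≡N) ⟨
    ∏ (λ i → M i ! * k ^ M i * N ^ B i) ^ (2 * k)
      ≡⟨ prod-^ {k} _ (2 * k) ⟨
    ∏ (λ i → (M i ! * k ^ M i * N ^ B i) ^ (2 * k))
      ≤⟨ prod-mono-≤ (λ i → letter-factor-bound ≤-refl (3u<N i) (e^3u²≤N^N i) (N<kB+k i) (kB≤N+k i)) ⟩
    ∏ (λ i → (B i ! * k ^ B i * N ^ M i) ^ (2 * k) * c)
      ≡⟨ prod-distrib-* (λ i → (B i ! * k ^ B i * N ^ M i) ^ (2 * k)) (λ _ → c) ⟩
    ∏ (λ i → (B i ! * k ^ B i * N ^ M i) ^ (2 * k)) * ∏ (λ _ → c)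
      ≡⟨ cong₂ _*_ (trans (prod-^ {k} _ (2 * k)) (cong (_^ (2 * k)) (letters B M ΣB≡N ΣM≡N))) (prod-const k c) ⟩
    (G * ∏B!) ^ (2 * k) * c ^ k ∎)))
  where
  open ≤-Reasoning
  c = N * 2 ^ (4 * k)
  G = k ^ N * N ^ N
  ∏ : (Fin k → ℕ) → ℕ
  ∏ = prod
  ∏M! = ∏ (λ i → M i !)
  ∏B! = ∏ (λ i → B i !)
  instance
    G≢0 : NonZero G
    G≢0 = m*n≢0 (k ^ N) (N ^ N) {{m^n≢0 k N}} {{m^n≢0 N N}}
  letters : ∀ (X Y : Fin k → ℕ) → sum X ≡ N → sum Y ≡ N →
    ∏ (λ i → X i ! * k ^ X i * N ^ Y i) ≡ G * ∏ (λ i → X i !)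
  letters X Y ΣX≡N ΣY≡N = trans (prod-letter-factors X Y N)
    (trans (cong₂ (λ a b → ∏ (λ i → X i !) * (k ^ a * N ^ b)) ΣX≡N ΣY≡N) (*-comm _ G))

multinomialConstant : ℕ → ℕ
multinomialConstant k = (k ^ k) ² * (2 ^ k) ² * 2 ^ (4 * k)

multinomialConstant≢0 : ∀ m → NonZero (multinomialConstant (suc m))
multinomialConstant≢0 m =
  m*n≢0 _ _ {{m*n≢0 _ _ {{square≢0 (m^n≢0 (suc m) (suc m))}} {{square≢0 (m^n≢0 2 (suc m))}}}} {{m^n≢0 2 (4 * suc m)}}
  where
  square≢0 : ∀ {n} → NonZero n → NonZero (n ²)
  square≢0 {n} n≢0 = m*n≢0 n n {{n≢0}} {{n≢0}}

module _ (m : ℕ) where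

  private
    k = suc m

  balanced-bound : ∀ n q r → n ≡ k * suc q + r → r < k →
    (k ^ n * prod (λ i → balanced {k} (suc q) r i !)) ² * (n * 2 ^ (4 * k)) ≤ multinomialConstant k * (n !) ² * n ^ k
  balanced-bound n q r n≡kQ+r r<k = begin
    (k ^ n * prod (λ i → balanced {k} Q r i !)) ² * c
      ≡⟨ cong (λ z → z ² * c) (cong₂ (λ a b → k ^ a * b) n≡kQ+r (prod!-balanced k Q r r≤k)) ⟩
    (k ^ (k * Q + r) * ((Q !) ^ k * suc Q ^ r)) ² * c
      ≤⟨ *-monoˡ-≤ c (central-bound-with-remainder m q r r≤k) ⟩
    K₀ * (((k * Q + r) !) ² * Q ^ m) * c
      ≡⟨ cong (λ z → K₀ * ((z !) ² * Q ^ m) * c) n≡kQ+r ⟨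
    K₀ * ((n !) ² * Q ^ m) * c
      ≤⟨ *-monoˡ-≤ c (*-monoʳ-≤ K₀ (*-monoʳ-≤ ((n !) ²) (^-monoˡ-≤ m Q≤n))) ⟩
    K₀ * ((n !) ² * n ^ m) * (n * 2 ^ (4 * k))
      ≡⟨ regroup K₀ ((n !) ²) (n ^ m) n (2 ^ (4 * k)) ⟩
    K₀ * 2 ^ (4 * k) * (n !) ² * (n * n ^ m) ∎
    where
    open ≤-Reasoning
    Q = suc q
    K₀ = (k ^ k) ² * (2 ^ k) ²
    c = n * 2 ^ (4 * k)
    r≤k = <⇒≤ r<k
    Q≤n : Q ≤ n
    Q≤n = ≤-trans (m≤n*m Q k) (≤-trans (m≤m+n (k * Q) r) (≤-reflexive (sym n≡kQ+r)))
    regroup : ∀ K f p n t → K * (f * p) * (n * t) ≡ K * t * f * (n * p)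
    regroup = solve-∀

  prod!-lower-bound : ∀ n (M : Fin k → ℕ) → k ≤ n → 7 ≤ n → sum M ≡ n →
    (∀ i → ExpLe (3 * ∣ k * M i - n ∣ ²) (n ^ n)) →
    (k ^ n) ² * prod (λ i → M i !) ² ≤ multinomialConstant k * (n !) ² * n ^ k
  prod!-lower-bound n M k≤n 7≤n ΣM≡n e^3u²≤n^n with divide-with-positive-quotient n k k≤n
  ... | q , r , r<k , n≡kQ+r = begin
    (k ^ n) ² * ∏M! ²          ≤⟨ *-monoʳ-≤ ((k ^ n) ²) (prod!-bound M B ΣM≡n ΣB≡n 3u<n′ e^3u²≤n^n N<kB+k kB≤N+k) ⟩
    (k ^ n) ² * (∏B! ² * c)    ≡⟨ *-assoc ((k ^ n) ²) (∏B! ²) c ⟨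
    (k ^ n) ² * ∏B! ² * c      ≡⟨ cong (_* c) (*-distrib-² (k ^ n) ∏B!) ⟨
    (k ^ n * ∏B!) ² * c        ≤⟨ balanced-bound n q r n≡kQ+r r<k ⟩
    multinomialConstant k * (n !) ² * n ^ k ∎
    where
    open ≤-Reasoning
    B = balanced {k} (suc q) r
    c = n * 2 ^ (4 * k)
    ∏M! = prod (λ i → M i !)
    ∏B! = prod (λ i → B i !)
    instance
      n≢0 : NonZero n
      n≢0 = >-nonZero (≤-trans (s≤s z≤n) 7≤n)
    ΣB≡n : sum B ≡ n
    ΣB≡n = trans (sum-balanced k (suc q) r (<⇒≤ r<k)) (sym n≡kQ+r)
    3u<n′ : ∀ i → 3 * ∣ k * M i - n ∣ < n
    3u<n′ i = 3u<n {u = ∣ k * M i - n ∣} 7≤n (e^3u²≤n^n i)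
    N<kB+k : ∀ i → n < k * B i + k
    N<kB+k = n<k*balanced+k {k} {n} {suc q} {r} n≡kQ+r r<k
    kB≤N+k : ∀ i → k * B i ≤ n + k
    kB≤N+k = k*balanced≤n+k {k} {n} {suc q} {r} n≡kQ+r

  totalFixed-lower-bound : ∀ n (M : Fin k → ℕ) → k ≤ n → 7 ≤ n → sum M ≡ n →
    (∀ i → ExpLe (3 * ∣ k * M i - n ∣ ²) (n ^ n)) →
    (k ^ n) ² ≤ multinomialConstant k * totalFixed k n M ² * n ^ k
  totalFixed-lower-bound n M k≤n 7≤n ΣM≡n e^3u²≤n^n = *-cancelʳ-≤ _ _ (∏M! ²) (begin
    (k ^ n) ² * ∏M! ²                 ≤⟨ prod!-lower-bound n M k≤n 7≤n ΣM≡n e^3u²≤n^n ⟩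
    K * (n !) ² * n ^ k               ≡⟨ cong (λ z → K * z ² * n ^ k) (totalFixed*prod!≡! k n M ΣM≡n) ⟨
    K * (T * ∏M!) ² * n ^ k           ≡⟨ regroup K T ∏M! (n ^ k) ⟩
    K * T ² * n ^ k * ∏M! ²           ∎)
    where
    open ≤-Reasoning
    K = multinomialConstant k
    T = totalFixed k n M
    ∏M! = prod (λ i → M i !)
    ∏M!≢0 : NonZero ∏M!
    ∏M!≢0 = >-nonZero (prod-positive (λ i → M i !) (λ i → >-nonZero⁻¹ (M i !) {{M i !≢0}}))
    instance
      ∏M!²≢0 : NonZero (∏M! ²)
      ∏M!²≢0 = m*n≢0 ∏M! ∏M! {{∏M!≢0}} {{∏M!≢0}}
    regroup : ∀ K T p x → K * ((T * p) * (T * p)) * x ≡ K * (T * T) * x * (p * p)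
    regroup = solve-∀

≤-of-squares : ∀ {x T K y z} {{_ : NonZero K}} {{_ : NonZero y}} → (K * x) ^ 2 * y ≤ z → z ≤ K * T ² * y → x ≤ T
≤-of-squares {x} {T} {K} {y} {z} [Kx]²y≤z z≤KT²y =
  ^-cancelʳ-≤ 2 (subst₂ _≤_ (sym (x^2≡x² x)) (sym (x^2≡x² T)) (≤-trans (m≤n*m (x ²) K) Kx²≤T²))
  where
  Kx²≤T² : K * x ² ≤ T ²
  Kx²≤T² = *-cancelˡ-≤ K (begin
    K * (K * x ²)  ≡⟨ regroup K x ⟩
    (K * x) ²      ≡⟨ x^2≡x² (K * x) ⟨
    (K * x) ^ 2    ≤⟨ *-cancelʳ-≤ _ _ y (≤-trans [Kx]²y≤z z≤KT²y) ⟩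
    K * T ²        ∎)
    where
    open ≤-Reasoning
    regroup : ∀ K x → K * (K * (x * x)) ≡ (K * x) * (K * x)
    regroup = solve-∀

badFixed-bound : ∀ m ε n (Q : Word (suc m) n → Bool) (M : Fin (suc m) → ℕ) → suc m ≤ n → 7 ≤ n →
  sumFin (suc m) M ≡ n → (∀ i → DevBound (suc m) n (M i)) →
  (suc (pred (suc ε * multinomialConstant (suc m))) * badAll (suc m) n Q) ^ 2 * n ^ suc m ≤ (suc m ^ n) ^ 2 →
  suc ε * badFixed (suc m) n M Q ≤ totalFixed (suc m) n M
badFixed-bound m ε n Q M k≤n 7≤n ΣM≡n dev bad-all-bound =
  ≤-trans (*-monoʳ-≤ (suc ε) (badFixed≤badAll k n M Q))
    (≤-of-squares {K = K} {y = n ^ k} {{K≢0}} {{m^n≢0 n k {{n≢0}}}}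
      (subst (λ z → z ^ 2 * n ^ k ≤ (k ^ n) ^ 2) (1+ε′≡K[1+ε] (badAll k n Q)) bad-all-bound)
      (subst (_≤ K * totalFixed k n M ² * n ^ k) (sym (x^2≡x² (k ^ n)))
        (totalFixed-lower-bound m n M k≤n 7≤n (trans (sym (sumFin≡sum k M)) ΣM≡n) (LeLog⇒ExpLe ∘ dev))))
  where
  k = suc m
  K = multinomialConstant k
  K≢0 = multinomialConstant≢0 m
  n≢0 = >-nonZero (≤-trans (s≤s z≤n) 7≤n)
  1+ε′≡K[1+ε] : ∀ b → suc (pred (suc ε * K)) * b ≡ K * (suc ε * b)
  1+ε′≡K[1+ε] b = trans (cong (_* b) (trans (suc-pred (suc ε * K) {{m*n≢0 (suc ε) K {{_}} {{K≢0}}}}) (*-comm (suc ε) K)))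
    (*-assoc K (suc ε) b)

proposition3p3 : (k : ℕ) → 2 ≤ k →
    (Q : (n : ℕ) → Word k n → Bool) →
    -- Pr(W_k(n) ∉ Q) · n^{k/2} → 0  (squared form, all in ℕ)
    (∀ (ε : ℕ) → ∃ λ N → ∀ n → N ≤ n →
        (suc ε * badAll k n (Q n)) ^ 2 * n ^ k ≤ (k ^ n) ^ 2) →
    (M : (n : ℕ) → Fin k → ℕ) →
    (∃ λ N₀ → ∀ n → N₀ ≤ n →
        (sumFin k (M n) ≡ n) × (∀ i → DevBound k n (M n i))) →
    -- Pr(W(n; M(n)) ∉ Q) → 0
    (∀ (ε : ℕ) → ∃ λ N → ∀ n → N ≤ n →
        suc ε * badFixed k n (M n) (Q n) ≤ totalFixed k n (M n))
proposition3p3 zero ()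
proposition3p3 (suc m) _ Q bad-all-rare M (N₀ , near-balanced) ε
  with N₁ , bad-all-bound ← bad-all-rare (pred (suc ε * multinomialConstant (suc m))) =
  N₀ ⊔ N₁ ⊔ 7 ⊔ suc m , λ n N≤n →
    badFixed-bound m ε n (Q n) (M n) (k≤n N≤n) (7≤n N≤n) (proj₁ (near-balanced n (N₀≤n N≤n)))
      (proj₂ (near-balanced n (N₀≤n N≤n))) (bad-all-bound n (N₁≤n N≤n))
  where
  module _ {n} (N≤n : N₀ ⊔ N₁ ⊔ 7 ⊔ suc m ≤ n) where
    N₀⊔N₁⊔7≤n = m⊔n≤o⇒m≤o (N₀ ⊔ N₁ ⊔ 7) (suc m) N≤n
    k≤n = m⊔n≤o⇒n≤o (N₀ ⊔ N₁ ⊔ 7) (suc m) N≤n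
    7≤n = m⊔n≤o⇒n≤o (N₀ ⊔ N₁) 7 N₀⊔N₁⊔7≤n
    N₀≤n = m⊔n≤o⇒m≤o N₀ N₁ (m⊔n≤o⇒m≤o (N₀ ⊔ N₁) 7 N₀⊔N₁⊔7≤n)
    N₁≤n = m⊔n≤o⇒n≤o N₀ N₁ (m⊔n≤o⇒m≤o (N₀ ⊔ N₁) 7 N₀⊔N₁⊔7≤n)
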